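{- The variety generated by the time warp algebra $\mathbf{W}$ does not have the finite model property, and it does not contain (the involutive residuated lattice term-equivalent to) $\mathbf{Res}(\mathbf{C})$ for any finite chain $\mathbf{C}$ with at least two elements.
   Context: Let $\omega^+=\omega\cup\{\omega\}$ with its natural order. A time warp is a join-preserving map $\omega^+\to\omega^+$ (equivalently, order-preserving with $f(0)=0$ and $f(\omega)=\sup_{n\in\omega}f(n)$). With $p$ the predecessor time warp ($p(0)=0$, $p(\omega)=\omega$, $p(m)=m-1$ otherwise), $\mathbf{W}=\langle W,\wedge,\vee,\circ,{}',\mathrm{id}\rangle$ is the set of time warps with pointwise $\wedge,\vee$, composition, identity, and $f'$ the largest time warp $g$ with $f\circ g\le p$. For a complete chain $\mathbf{C}$ (least element $0$, greatest $\infty$), $\mathrm{res}(\mathbf{C})$ is the set of join-preserving maps $C\to C$, $d(x)=\bigvee\{y\mid y<x\}$, and $\mathbf{Res}(\mathbf{C})$ is regarded as the involutive residuated lattice $\langle \mathrm{res}(\mathbf{C}),\wedge,\vee,\circ,{}',\mathrm{id}\rangle$ with pointwise lattice operations and $f'$ the largest $g\in\mathrm{res}(\mathbf{C})$ with $f\circ g\le d$. The variety generated by $\mathbf{W}$ is the class of all algebras of the signature $\langle\wedge,\vee,\cdot,{}',1\rangle$ satisfying every equation satisfied by $\mathbf{W}$. A variety has the finite model property if every equation failing in some member of it fails in some finite member. -}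

module Defs where

open import Level using (Level) renaming (suc to lsuc; zero to lzero; _⊔_ to _⊔ˡ_)
open import Data.Nat as ℕ using (ℕ; zero; suc)
open import Data.Fin as F using (Fin; zero; suc)
open import Data.Product using (Σ; _×_; _,_)
open import Relation.Nullary using (¬_)
open import Relation.Binary.PropositionalEquality using (_≡_)
open import Relation.Binary.Structures using (IsEquivalence)

infixl 7 _·_
infixl 6 _∧_
infixl 5 _∨_

data Term : Set where
  var       : ℕ → Term
  _∧_ _∨_ _·_ : Term → Term → Term
  _′        : Term → Term
  one       : Term

record Chain : Set₁ where
  field
    C    : Set
    _≤_  : C → C → Set
    _⊓_  : C → C → C
    _⊔_  : C → C → C
    δ    : C → C          -- d(x) = ⋁ {y | y < x}

module _ (K : Chain) where
  open Chain K

  IsSup : (C → Set) → C → Set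
  IsSup S x = (∀ y → S y → y ≤ x) × (∀ u → (∀ y → S y → y ≤ u) → x ≤ u)

  JoinPreserving : (C → C) → Set₁
  JoinPreserving f =
    ∀ (S : C → Set) x → IsSup S x → IsSup (λ y → Σ C λ z → S z × (f z ≡ y)) (f x)

  IsRes′ : ((C → C) → (C → C)) → Set₁
  IsRes′ neg = ∀ f → JoinPreserving f →
      JoinPreserving (neg f)
    × (∀ x → f (neg f x) ≤ δ x)
    × (∀ g → JoinPreserving g → (∀ x → f (g x) ≤ δ x) → ∀ x → g x ≤ neg f x)

  evalR : ((C → C) → (C → C)) → (ℕ → C → C) → Term → C → C
  evalR neg ρ (var i) = ρ i
  evalR neg ρ (s ∧ t) = λ x → evalR neg ρ s x ⊓ evalR neg ρ t x
  evalR neg ρ (s ∨ t) = λ x → evalR neg ρ s x ⊔ evalR neg ρ t x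
  evalR neg ρ (s · t) = λ x → evalR neg ρ s (evalR neg ρ t x)
  evalR neg ρ (s ′)   = neg (evalR neg ρ s)
  evalR neg ρ one     = λ x → x

  SatRes : ((C → C) → (C → C)) → Term → Term → Set₁
  SatRes neg s t = ∀ (ρ : ℕ → C → C) → (∀ i → JoinPreserving (ρ i)) →
    ∀ x → evalR neg ρ s x ≡ evalR neg ρ t x

data ω⁺ : Set where
  fin : ℕ → ω⁺
  ω   : ω⁺

data _≤ω_ : ω⁺ → ω⁺ → Set where
  fin≤fin : ∀ {m n} → m ℕ.≤ n → fin m ≤ω fin n
  x≤ω     : ∀ {x} → x ≤ω ω

_⊓ω_ : ω⁺ → ω⁺ → ω⁺
fin m ⊓ω fin n = fin (m ℕ.⊓ n)
fin m ⊓ω ω     = fin m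
ω     ⊓ω y     = y

_⊔ω_ : ω⁺ → ω⁺ → ω⁺
fin m ⊔ω fin n = fin (m ℕ.⊔ n)
fin m ⊔ω ω     = ω
ω     ⊔ω y     = ω

p : ω⁺ → ω⁺
p (fin zero)    = fin zero
p (fin (suc m)) = fin m
p ω             = ω

ω⁺Chain : Chain
ω⁺Chain = record { C = ω⁺ ; _≤_ = _≤ω_ ; _⊓_ = _⊓ω_ ; _⊔_ = _⊔ω_ ; δ = p }

-- Time warps are exactly the join-preserving maps ω⁺ → ω⁺
TimeWarp : (ω⁺ → ω⁺) → Set₁
TimeWarp = JoinPreserving ω⁺Chain

SatW : ((ω⁺ → ω⁺) → (ω⁺ → ω⁺)) → Term → Term → Set₁
SatW = SatRes ω⁺Chain

maxF : ∀ {n} → Fin n → Fin n → Fin n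
maxF zero    j       = j
maxF (suc i) zero    = suc i
maxF (suc i) (suc j) = suc (maxF i j)

minF : ∀ {n} → Fin n → Fin n → Fin n
minF zero    j       = zero
minF (suc i) zero    = zero
minF (suc i) (suc j) = suc (minF i j)

-- d(x) = ⋁{y | y < x}: predecessor, with d(0) = 0
FinChain : ℕ → Chain
FinChain n = record { C = Fin n ; _≤_ = F._≤_ ; _⊓_ = minF ; _⊔_ = maxF ; δ = F.pred }

record Alg (c ℓ : Level) : Set (lsuc (c ⊔ˡ ℓ)) where
  field
    Carrier : Set c
    _≈_     : Carrier → Carrier → Set ℓ
    isEquivalence : IsEquivalence _≈_
    _∧ᴬ_ _∨ᴬ_ _·ᴬ_ : Carrier → Carrier → Carrier
    _′ᴬ     : Carrier → Carrier
    1ᴬ      : Carrier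
    ∧-cong  : ∀ {x y u v} → x ≈ y → u ≈ v → (x ∧ᴬ u) ≈ (y ∧ᴬ v)
    ∨-cong  : ∀ {x y u v} → x ≈ y → u ≈ v → (x ∨ᴬ u) ≈ (y ∨ᴬ v)
    ·-cong  : ∀ {x y u v} → x ≈ y → u ≈ v → (x ·ᴬ u) ≈ (y ·ᴬ v)
    ′-cong  : ∀ {x y} → x ≈ y → (x ′ᴬ) ≈ (y ′ᴬ)

module _ {c ℓ : Level} (A : Alg c ℓ) where
  open Alg A

  evalA : (ℕ → Carrier) → Term → Carrier
  evalA ρ (var i) = ρ i
  evalA ρ (s ∧ t) = evalA ρ s ∧ᴬ evalA ρ t
  evalA ρ (s ∨ t) = evalA ρ s ∨ᴬ evalA ρ t
  evalA ρ (s · t) = evalA ρ s ·ᴬ evalA ρ t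
  evalA ρ (s ′)   = evalA ρ s ′ᴬ
  evalA ρ one     = 1ᴬ

  Sat : Term → Term → Set (c ⊔ˡ ℓ)
  Sat s t = ∀ (ρ : ℕ → Carrier) → evalA ρ s ≈ evalA ρ t

  Finite : Set (c ⊔ˡ ℓ)
  Finite = Σ ℕ λ n → Σ (Fin n → Carrier) λ e → ∀ x → Σ (Fin n) λ i → e i ≈ x

InVW : ∀ {c ℓ} → ((ω⁺ → ω⁺) → (ω⁺ → ω⁺)) → Alg c ℓ → Set (lsuc lzero ⊔ˡ c ⊔ˡ ℓ)
InVW negW A = ∀ s t → SatW negW s t → Sat A s t

HasFMP : ((ω⁺ → ω⁺) → (ω⁺ → ω⁺)) → (c ℓ : Level) → Set (lsuc lzero ⊔ˡ lsuc (c ⊔ˡ ℓ))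
HasFMP negW c ℓ = ∀ s t →
  Σ (Alg c ℓ) (λ A → InVW negW A × ¬ Sat A s t) →
  Σ (Alg c ℓ) (λ A → InVW negW A × Finite A × ¬ Sat A s t)

-- In W the closed terms 𝟘 = 1′ and 𝟘⁻¹ = (𝟘 · 𝟘)′ evaluate to the predecessor p and
-- to the map 0 ↦ 0, n ↦ n + 1 (n ≥ 1); so W satisfies 𝟘 · 𝟘⁻¹ ≈ 1 but not 𝟘⁻¹ · 𝟘 ≈ 1.
-- Every member of V(W) is a monoid under ·, and in a finite monoid a one-sided inverse
-- is two-sided, so finite members of V(W) satisfy 𝟘⁻¹ · 𝟘 ≈ 1 while W itself does not.
-- In Res(C) for a finite chain with at least two elements, 1′ ≤ d and d(y) < ⊤ for all y,
-- so 𝟘 · 𝟘⁻¹ cannot fix ⊤.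
module Submission where

open import Defs
open import Level using (Level; Lift; lift; lower)
open import Data.Fin using (Fin)
open import Data.Nat using (ℕ; _≤_; zero; suc; z≤n; s≤s; _+_)
open import Data.Product using (_×_; Σ; _,_; proj₁; proj₂)
open import Relation.Nullary using (¬_; Dec; yes; no)

open import Algebra.Bundles using (Monoid)
import Algebra.Properties.Monoid as MonoidProperties
import Algebra.Properties.Monoid.Mult as MonoidMult
import Data.Fin as F
import Data.Fin.Properties as FP
import Data.Nat as N
import Data.Nat.Properties as NP
import Relation.Binary.Reasoning.Setoid as ≈-Reasoning
open import Data.Sum using (_⊎_; inj₁; inj₂; [_,_]′)
open import Data.Empty using (⊥; ⊥-elim)
open import Function using (_∘_; _$_)
open import Relation.Nullary.Decidable using (decidable-stable)
open import Relation.Binary.PropositionalEquality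
  using (_≡_; _≢_; refl; sym; trans; cong; cong₂; cong-app; subst; module ≡-Reasoning)

private
  variable
    c ℓ : Level

module _ (K : Chain) where
  open Chain K using (C; δ) renaming (_≤_ to _≤ᴷ_)

  IsSup-resp : ∀ {S T : C → Set} {x} → (∀ y → T y → S y) → (∀ y → S y → T y) →
               IsSup K S x → IsSup K T x
  IsSup-resp T⊆S S⊆T (upper , least) =
    (λ y Ty → upper y (T⊆S y Ty)) , (λ u bound → least u (λ y Sy → bound y (S⊆T y Sy)))

  id-joinPreserving : JoinPreserving K (λ x → x)
  id-joinPreserving S x sup =
    IsSup-resp (λ { y (z , Sz , refl) → Sz }) (λ y Sy → y , Sy , refl) sup

  ∘-joinPreserving : ∀ {f g} → JoinPreserving K f → JoinPreserving K g →
                     JoinPreserving K (λ x → f (g x))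
  ∘-joinPreserving {f} {g} f-jp g-jp S x sup =
    IsSup-resp (λ { y (z , Sz , refl) → g z , (z , Sz , refl) , refl })
               (λ { y (_ , (z , Sz , refl) , refl) → z , Sz , refl })
               (f-jp _ _ (g-jp S x sup))

  module Res′ {neg : (C → C) → (C → C)} (isRes′ : IsRes′ K neg) {f : C → C}
              (f-jp : JoinPreserving K f) where

    ′-joinPreserving : JoinPreserving K (neg f)
    ′-joinPreserving = proj₁ (isRes′ f f-jp)

    ′-below-δ : ∀ x → f (neg f x) ≤ᴷ δ x
    ′-below-δ = proj₁ (proj₂ (isRes′ f f-jp))

    ′-greatest : ∀ {g} → JoinPreserving K g → (∀ x → f (g x) ≤ᴷ δ x) → ∀ x → g x ≤ᴷ neg f x
    ′-greatest {g} = proj₂ (proj₂ (isRes′ f f-jp)) g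

  ·-assoc-Res : ∀ neg → SatRes K neg ((var 0 · var 1) · var 2) (var 0 · (var 1 · var 2))
  ·-assoc-Res neg ρ _ x = refl

  ·-identityˡ-Res : ∀ neg → SatRes K neg (one · var 0) (var 0)
  ·-identityˡ-Res neg ρ _ x = refl

  ·-identityʳ-Res : ∀ neg → SatRes K neg (var 0 · one) (var 0)
  ·-identityʳ-Res neg ρ _ x = refl

-- Finite monoids are Dedekind-finite

module _ (M : Monoid c ℓ) where
  open Monoid M using (Carrier; _≈_; _∙_; ε; setoid; ∙-congˡ)
    renaming (sym to ≈-sym; trans to ≈-trans)
  open MonoidProperties M using (cancelˡ; elimʳ)
  open MonoidMult M using () renaming (_×_ to _×ᴹ_)

  infixl 8 _^_
  _^_ : Carrier → ℕ → Carrier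
  a ^ m = m ×ᴹ a

  IsFinite : Set (c Level.⊔ ℓ)
  IsFinite = Σ ℕ λ n → Σ (Fin n → Carrier) λ e → ∀ x → Σ (Fin n) λ i → e i ≈ x

  some-power-repeats : IsFinite → ∀ a → Σ ℕ λ i → Σ ℕ λ m → a ^ (i + suc m) ≈ a ^ i
  some-power-repeats (n , e , cover) a
    with k , k′ , k<k′ , same-index ← FP.pigeonhole (NP.n<1+n n) (λ k → proj₁ (cover (a ^ F.toℕ k)))
    with o , 1+k+o≡k′ ← NP.m≤n⇒∃[o]m+o≡n k<k′
    = F.toℕ k , o , (begin
      a ^ (F.toℕ k + suc o) ≡⟨ cong (a ^_) (trans (NP.+-suc (F.toℕ k) o) 1+k+o≡k′) ⟩
      a ^ F.toℕ k′          ≈⟨ cover (a ^ F.toℕ k′) .proj₂ ⟨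
      e (cover (a ^ F.toℕ k′) .proj₁) ≡⟨ cong e same-index ⟨
      e (cover (a ^ F.toℕ k) .proj₁)  ≈⟨ cover (a ^ F.toℕ k) .proj₂ ⟩
      a ^ F.toℕ k           ∎)
    where open ≈-Reasoning setoid

  ^-cancelˡ : ∀ {z a} → z ∙ a ≈ ε → ∀ i {m} → a ^ (i + m) ≈ a ^ i → a ^ m ≈ ε
  ^-cancelˡ z∙a≈ε zero    aᵐ≈ε = aᵐ≈ε
  ^-cancelˡ z∙a≈ε (suc i) a¹⁺ⁱ⁺ᵐ≈a¹⁺ⁱ =
    ^-cancelˡ z∙a≈ε i
      (≈-trans (≈-sym (cancelˡ z∙a≈ε _)) (≈-trans (∙-congˡ a¹⁺ⁱ⁺ᵐ≈a¹⁺ⁱ) (cancelˡ z∙a≈ε _)))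

  finite⇒dedekind-finite : IsFinite → ∀ {z a} → z ∙ a ≈ ε → a ∙ z ≈ ε
  finite⇒dedekind-finite finite {z} {a} z∙a≈ε = begin
    a ∙ z     ≈⟨ ∙-congˡ z≈aᵐ ⟩
    a ∙ a ^ m ≈⟨ a¹⁺ᵐ≈ε ⟩
    ε         ∎
    where
    open ≈-Reasoning setoid
    i = some-power-repeats finite a .proj₁
    m = some-power-repeats finite a .proj₂ .proj₁
    a¹⁺ᵐ≈ε : a ∙ a ^ m ≈ ε
    a¹⁺ᵐ≈ε = ^-cancelˡ z∙a≈ε i (some-power-repeats finite a .proj₂ .proj₂)
    z≈aᵐ : z ≈ a ^ m
    z≈aᵐ = ≈-trans (≈-sym (elimʳ a¹⁺ᵐ≈ε z)) (cancelˡ z∙a≈ε (a ^ m))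

module _ (A : Alg c ℓ) where
  open Alg A

  ·-monoid : Sat A ((var 0 · var 1) · var 2) (var 0 · (var 1 · var 2)) →
             Sat A (one · var 0) (var 0) → Sat A (var 0 · one) (var 0) → Monoid c ℓ
  ·-monoid assoc identityˡ identityʳ = record
    { Carrier = Carrier
    ; _≈_ = _≈_
    ; _∙_ = _·ᴬ_
    ; ε = 1ᴬ
    ; isMonoid = record
      { isSemigroup = record
        { isMagma = record { isEquivalence = isEquivalence ; ∙-cong = ·-cong }
        ; assoc = λ x y z → assoc (env x y z) }
      ; identity = (λ x → identityˡ (env x x x)) , (λ x → identityʳ (env x x x)) }
    }
    where
    env : Carrier → Carrier → Carrier → ℕ → Carrier
    env x y z 0 = x
    env x y z 1 = y
    env x y z _ = z

≤ω-refl : ∀ {x} → x ≤ω x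
≤ω-refl {fin n} = fin≤fin NP.≤-refl
≤ω-refl {ω}     = x≤ω

≤ω-trans : ∀ {x y z} → x ≤ω y → y ≤ω z → x ≤ω z
≤ω-trans (fin≤fin m≤n) (fin≤fin n≤k) = fin≤fin (NP.≤-trans m≤n n≤k)
≤ω-trans _             x≤ω           = x≤ω

≤ω-antisym : ∀ {x y} → x ≤ω y → y ≤ω x → x ≡ y
≤ω-antisym (fin≤fin m≤n) (fin≤fin n≤m) = cong fin (NP.≤-antisym m≤n n≤m)
≤ω-antisym x≤ω           x≤ω           = refl

_≤ω?_ : ∀ x y → Dec (x ≤ω y)
fin m ≤ω? fin n with m N.≤? n
... | yes m≤n = yes (fin≤fin m≤n)
... | no  m≰n = no λ { (fin≤fin m≤n) → m≰n m≤n }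
x     ≤ω? ω     = yes x≤ω
ω     ≤ω? fin n = no λ ()

≤ω-stable : ∀ {x y} → ¬ ¬ (x ≤ω y) → x ≤ω y
≤ω-stable {x} {y} = decidable-stable (x ≤ω? y)

≤ω-total : ∀ x y → x ≤ω y ⊎ y ≤ω x
≤ω-total (fin m) (fin n) = Data.Sum.map fin≤fin fin≤fin (NP.≤-total m n)
≤ω-total x       ω       = inj₁ x≤ω
≤ω-total ω       (fin n) = inj₂ x≤ω

0≤ω : ∀ {x} → fin 0 ≤ω x
0≤ω {fin n} = fin≤fin z≤n
0≤ω {ω}     = x≤ω

≤ω0⇒≡0 : ∀ {x} → x ≤ω fin 0 → x ≡ fin 0
≤ω0⇒≡0 (fin≤fin z≤n) = refl

1+n≰ωn : ∀ {n} → ¬ (fin (suc n) ≤ω fin n)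
1+n≰ωn (fin≤fin 1+n≤n) = NP.<-irrefl refl 1+n≤n

≤ω1+n⇒≤ωn : ∀ {x n} → x ≤ω fin (suc n) → x ≢ fin (suc n) → x ≤ω fin n
≤ω1+n⇒≤ωn {fin m} (fin≤fin m≤1+n) x≢1+n with NP.m≤n⇒m<n∨m≡n m≤1+n
... | inj₁ (s≤s m≤n) = fin≤fin m≤n
... | inj₂ refl      = ⊥-elim (x≢1+n refl)

⊔ω-mono : ∀ {x x′ y y′} → x ≤ω x′ → y ≤ω y′ → (x ⊔ω y) ≤ω (x′ ⊔ω y′)
⊔ω-mono (fin≤fin m≤m′) (fin≤fin n≤n′) = fin≤fin (NP.⊔-mono-≤ m≤m′ n≤n′)
⊔ω-mono {x′ = ω}              _ _ = x≤ω
⊔ω-mono {x′ = fin _} {y′ = ω} _ _ = x≤ω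

⊔ω-lub : ∀ {x y u} → x ≤ω u → y ≤ω u → (x ⊔ω y) ≤ω u
⊔ω-lub {u = ω} _ _ = x≤ω
⊔ω-lub (fin≤fin m≤u) (fin≤fin n≤u) = fin≤fin (NP.⊔-lub m≤u n≤u)

x≤ωx⊔ωy : ∀ x y → x ≤ω (x ⊔ω y)
x≤ωx⊔ωy (fin m) (fin n) = fin≤fin (NP.m≤m⊔n m n)
x≤ωx⊔ωy (fin m) ω       = x≤ω
x≤ωx⊔ωy ω       y       = x≤ω

y≤ωx⊔ωy : ∀ x y → y ≤ω (x ⊔ω y)
y≤ωx⊔ωy (fin m) (fin n) = fin≤fin (NP.m≤n⊔m m n)
y≤ωx⊔ωy (fin m) ω       = x≤ω
y≤ωx⊔ωy ω       y       = x≤ω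

x⊓ωy≤ωx : ∀ x y → (x ⊓ω y) ≤ω x
x⊓ωy≤ωx (fin m) (fin n) = fin≤fin (NP.m⊓n≤m m n)
x⊓ωy≤ωx (fin m) ω       = ≤ω-refl
x⊓ωy≤ωx ω       y       = x≤ω

x⊓ωy≤ωy : ∀ x y → (x ⊓ω y) ≤ω y
x⊓ωy≤ωy (fin m) (fin n) = fin≤fin (NP.m⊓n≤n m n)
x⊓ωy≤ωy (fin m) ω       = x≤ω
x⊓ωy≤ωy ω       y       = ≤ω-refl

⊓ω-mono : ∀ {x x′ y y′} → x ≤ω x′ → y ≤ω y′ → (x ⊓ω y) ≤ω (x′ ⊓ω y′)
⊓ω-mono (fin≤fin m≤m′) (fin≤fin n≤n′) = fin≤fin (NP.⊓-mono-≤ m≤m′ n≤n′)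
⊓ω-mono {x} {ω}     {y}     _    y≤y′ = ≤ω-trans (x⊓ωy≤ωy x y) y≤y′
⊓ω-mono {x} {fin _} {y} {ω} x≤x′ _    = ≤ω-trans (x⊓ωy≤ωx x y) x≤x′

⊓ω-sel : ∀ x y → (x ⊓ω y) ≡ x ⊎ (x ⊓ω y) ≡ y
⊓ω-sel (fin m) (fin n) = Data.Sum.map (cong fin) (cong fin) (NP.⊓-sel m n)
⊓ω-sel (fin m) ω       = inj₁ refl
⊓ω-sel ω       y       = inj₂ refl

⊓ω-≰ : ∀ {x y u} → ¬ (x ≤ω u) → ¬ (y ≤ω u) → ¬ ((x ⊓ω y) ≤ω u)
⊓ω-≰ {x} {y} {u} x≰u y≰u x⊓y≤u with ⊓ω-sel x y
... | inj₁ x⊓y≡x = x≰u (subst (_≤ω u) x⊓y≡x x⊓y≤u)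
... | inj₂ x⊓y≡y = y≰u (subst (_≤ω u) x⊓y≡y x⊓y≤u)

-- Time warps as order-preserving maps with f 0 = 0 and f ω = ⨆ f n

record IsTimeWarp (f : ω⁺ → ω⁺) : Set where
  field
    monotone   : ∀ {x y} → x ≤ω y → f x ≤ω f y
    preserves0 : f (fin 0) ≡ fin 0
    ω-least    : ∀ u → (∀ n → f (fin n) ≤ω u) → f ω ≤ω u

module _ {f : ω⁺ → ω⁺} (isTW : IsTimeWarp f) where
  open IsTimeWarp isTW

  ¬¬-exceeds : ∀ {u} → ¬ (f ω ≤ω u) → ¬ ¬ (Σ ℕ λ n → ¬ (f (fin n) ≤ω u))
  ¬¬-exceeds fω≰u no-witness = fω≰u (ω-least _ λ n → ≤ω-stable λ fn≰u → no-witness (n , fn≰u))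

  private
    sup-1+n-¬¬∈ : ∀ {S n} → IsSup ω⁺Chain S (fin (suc n)) → ¬ ¬ S (fin (suc n))
    sup-1+n-¬¬∈ {n = n} (upper , least) ∉S =
      1+n≰ωn (least (fin n) λ y Sy → ≤ω1+n⇒≤ωn (upper y Sy) λ { refl → ∉S Sy })

    sup-ω-unbounded : ∀ {S} → IsSup ω⁺Chain S ω → ∀ n → ¬ (∀ y → S y → y ≤ω fin n)
    sup-ω-unbounded (_ , least) n bounded with least (fin n) bounded
    ... | ()

    below-upper-bound : ∀ {S x u} → IsSup ω⁺Chain S x → (∀ y → S y → f y ≤ω u) → f x ≤ω u
    below-upper-bound {x = fin zero} _ _ rewrite preserves0 = 0≤ω
    below-upper-bound {x = fin (suc n)} sup bound =
      ≤ω-stable λ f1+n≰u → sup-1+n-¬¬∈ sup λ S1+n → f1+n≰u (bound _ S1+n)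
    below-upper-bound {S} {ω} {u} sup bound = ω-least u λ n → ≤ω-stable λ fn≰u →
      sup-ω-unbounded sup n λ y Sy →
        [ (λ y≤n → y≤n) , (λ n≤y → ⊥-elim (fn≰u (≤ω-trans (monotone n≤y) (bound y Sy)))) ]′
        (≤ω-total y (fin n))

  IsTimeWarp⇒TimeWarp : TimeWarp f
  IsTimeWarp⇒TimeWarp S x sup@(upper , _) =
    (λ { y (z , Sz , refl) → monotone (upper z Sz) })
    , (λ u bound → below-upper-bound sup λ z Sz → bound (f z) (z , Sz , refl))

TimeWarp⇒IsTimeWarp : ∀ {f} → TimeWarp f → IsTimeWarp f
TimeWarp⇒IsTimeWarp {f} f-jp = record
  { monotone = λ {x} {y} x≤y →
      proj₁ (f-jp (λ z → z ≡ x ⊎ z ≡ y) y (sup-pair x≤y)) (f x) (x , inj₁ refl , refl)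
  ; preserves0 = ≤ω0⇒≡0 (proj₂ (f-jp (λ _ → ⊥) (fin 0) sup-∅) (fin 0) λ { _ (_ , () , _) })
  ; ω-least = λ u bound → proj₂ (f-jp IsFin ω sup-fin) u λ { _ (_ , (n , refl) , refl) → bound n }
  }
  where
  sup-pair : ∀ {x y} → x ≤ω y → IsSup ω⁺Chain (λ z → z ≡ x ⊎ z ≡ y) y
  sup-pair x≤y =
    (λ { _ (inj₁ refl) → x≤y ; _ (inj₂ refl) → ≤ω-refl }) , (λ u bound → bound _ (inj₂ refl))

  sup-∅ : IsSup ω⁺Chain (λ _ → ⊥) (fin 0)
  sup-∅ = (λ _ ()) , (λ u _ → 0≤ω)

  IsFin : ω⁺ → Set
  IsFin z = Σ ℕ λ n → z ≡ fin n

  sup-fin : IsSup ω⁺Chain IsFin ω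
  sup-fin = (λ _ _ → x≤ω) , least
    where
    least : ∀ u → (∀ y → IsFin y → y ≤ω u) → ω ≤ω u
    least ω       _     = x≤ω
    least (fin m) bound = ⊥-elim (1+n≰ωn (bound _ (suc m , refl)))

id-isTimeWarp : IsTimeWarp (λ x → x)
id-isTimeWarp = TimeWarp⇒IsTimeWarp (id-joinPreserving ω⁺Chain)

p-isTimeWarp : IsTimeWarp p
p-isTimeWarp = record { monotone = monotone ; preserves0 = refl ; ω-least = ω-least }
  where
  monotone : ∀ {x y} → x ≤ω y → p x ≤ω p y
  monotone {y = ω}                          x≤ω                   = x≤ω
  monotone {fin zero}    {fin _}            _                     = 0≤ω
  monotone {fin (suc _)} {fin (suc _)}      (fin≤fin (s≤s m≤n))   = fin≤fin m≤n

  ω-least : ∀ u → (∀ n → p (fin n) ≤ω u) → ω ≤ω u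
  ω-least ω       _     = x≤ω
  ω-least (fin m) bound = ⊥-elim (1+n≰ωn (bound (2 + m)))

-- (p ∘ p)′ in W
shift : ω⁺ → ω⁺
shift (fin zero)    = fin zero
shift (fin (suc n)) = fin (2 + n)
shift ω             = ω

shift-isTimeWarp : IsTimeWarp shift
shift-isTimeWarp = record { monotone = monotone ; preserves0 = refl ; ω-least = ω-least }
  where
  monotone : ∀ {x y} → x ≤ω y → shift x ≤ω shift y
  monotone {y = ω}                     x≤ω           = x≤ω
  monotone {fin zero}    {fin _}       _             = 0≤ω
  monotone {fin (suc _)} {fin (suc _)} (fin≤fin m≤n) = fin≤fin (s≤s m≤n)

  ω-least : ∀ u → (∀ n → shift (fin n) ≤ω u) → ω ≤ω u
  ω-least ω       _     = x≤ω
  ω-least (fin m) bound = ⊥-elim (1+n≰ωn (≤ω-trans (fin≤fin (NP.n≤1+n (suc m))) (bound (suc m))))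

module _ {f g : ω⁺ → ω⁺} (f-isTW : IsTimeWarp f) (g-isTW : IsTimeWarp g) where
  private
    module f = IsTimeWarp f-isTW
    module g = IsTimeWarp g-isTW

  ⊔-isTimeWarp : IsTimeWarp (λ x → f x ⊔ω g x)
  ⊔-isTimeWarp = record
    { monotone   = λ x≤y → ⊔ω-mono (f.monotone x≤y) (g.monotone x≤y)
    ; preserves0 = cong₂ _⊔ω_ f.preserves0 g.preserves0
    ; ω-least    = λ u bound →
        ⊔ω-lub (f.ω-least u λ n → ≤ω-trans (x≤ωx⊔ωy _ _) (bound n))
               (g.ω-least u λ n → ≤ω-trans (y≤ωx⊔ωy _ _) (bound n))
    }

  -- If f ω ⊓ g ω exceeds u then (classically, as ≤ω is decidable) some f m and some g n
  -- exceed u, and then f and g both exceed u at m ⊔ n.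
  ⊓-isTimeWarp : IsTimeWarp (λ x → f x ⊓ω g x)
  ⊓-isTimeWarp = record
    { monotone   = λ x≤y → ⊓ω-mono (f.monotone x≤y) (g.monotone x≤y)
    ; preserves0 = cong₂ _⊓ω_ f.preserves0 g.preserves0
    ; ω-least    = ω-least
    }
    where
    ω-least : ∀ u → (∀ n → (f (fin n) ⊓ω g (fin n)) ≤ω u) → (f ω ⊓ω g ω) ≤ω u
    ω-least u bound = ≤ω-stable λ fω⊓gω≰u →
      ¬¬-exceeds f-isTW (fω⊓gω≰u ∘ ≤ω-trans (x⊓ωy≤ωx _ _)) λ (m , fm≰u) →
      ¬¬-exceeds g-isTW (fω⊓gω≰u ∘ ≤ω-trans (x⊓ωy≤ωy _ _)) λ (n , gn≰u) →
      ⊓ω-≰ (fm≰u ∘ ≤ω-trans (f.monotone (fin≤fin (NP.m≤m⊔n m n))))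
           (gn≰u ∘ ≤ω-trans (g.monotone (fin≤fin (NP.m≤n⊔m m n))))
           (bound (m N.⊔ n))

  ∘-isTimeWarp : IsTimeWarp (λ x → f (g x))
  ∘-isTimeWarp = TimeWarp⇒IsTimeWarp
    (∘-joinPreserving ω⁺Chain (IsTimeWarp⇒TimeWarp f-isTW) (IsTimeWarp⇒TimeWarp g-isTW))

p∘shift≗id : ∀ x → p (shift x) ≡ x
p∘shift≗id (fin zero)    = refl
p∘shift≗id (fin (suc n)) = refl
p∘shift≗id ω             = refl

p∘p≤ωn⇒≤ω2+n : ∀ {y n} → p (p y) ≤ω fin n → y ≤ω fin (2 + n)
p∘p≤ωn⇒≤ω2+n {fin zero}          _             = fin≤fin z≤n
p∘p≤ωn⇒≤ω2+n {fin (suc zero)}    _             = fin≤fin (s≤s z≤n)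
p∘p≤ωn⇒≤ω2+n {fin (suc (suc m))} (fin≤fin m≤n) = fin≤fin (s≤s (s≤s m≤n))

𝟘 : Term
𝟘 = one ′

𝟘⁻¹ : Term
𝟘⁻¹ = (𝟘 · 𝟘) ′

module W (negW : (ω⁺ → ω⁺) → (ω⁺ → ω⁺)) (isRes′ : IsRes′ ω⁺Chain negW) where
  open Res′ ω⁺Chain isRes′

  ′-cong : ∀ {f g} → TimeWarp f → TimeWarp g → (∀ x → f x ≡ g x) → ∀ x → negW f x ≡ negW g x
  ′-cong {f} {g} f-jp g-jp f≗g x = ≤ω-antisym (′-≤ f-jp g-jp f≗g) (′-≤ g-jp f-jp (sym ∘ f≗g))
    where
    ′-≤ : ∀ {f g} → TimeWarp f → TimeWarp g → (∀ x → f x ≡ g x) → negW f x ≤ω negW g x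
    ′-≤ {f} {g} f-jp g-jp f≗g = ′-greatest g-jp (′-joinPreserving f-jp)
      (λ y → subst (_≤ω p y) (f≗g (negW f y)) (′-below-δ f-jp y)) x

  1′≗p : ∀ x → negW (λ y → y) x ≡ p x
  1′≗p x = ≤ω-antisym (′-below-δ id-jp x)
                      (′-greatest id-jp (IsTimeWarp⇒TimeWarp p-isTimeWarp) (λ _ → ≤ω-refl) x)
    where id-jp = id-joinPreserving ω⁺Chain

  1′∘1′ : ω⁺ → ω⁺
  1′∘1′ y = negW (λ z → z) (negW (λ z → z) y)

  private
    1′-jp : TimeWarp (negW (λ z → z))
    1′-jp = ′-joinPreserving (id-joinPreserving ω⁺Chain)

    1′∘1′-jp : TimeWarp 1′∘1′
    1′∘1′-jp = ∘-joinPreserving ω⁺Chain 1′-jp 1′-jp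

    1′∘1′≗p∘p : ∀ y → 1′∘1′ y ≡ p (p y)
    1′∘1′≗p∘p y = trans (1′≗p _) (cong p (1′≗p y))

    shift≤[1′·1′]′ : ∀ x → shift x ≤ω negW 1′∘1′ x
    shift≤[1′·1′]′ = ′-greatest 1′∘1′-jp (IsTimeWarp⇒TimeWarp shift-isTimeWarp) λ y →
      subst (_≤ω p y) (sym (trans (1′∘1′≗p∘p _) (cong p (p∘shift≗id y)))) ≤ω-refl

  [1′·1′]′≗shift : ∀ x → negW 1′∘1′ x ≡ shift x
  [1′·1′]′≗shift (fin zero) =
    IsTimeWarp.preserves0 (TimeWarp⇒IsTimeWarp (′-joinPreserving 1′∘1′-jp))
  [1′·1′]′≗shift x@(fin (suc n)) = ≤ω-antisym
    (p∘p≤ωn⇒≤ω2+n (subst (_≤ω fin n) (1′∘1′≗p∘p _) (′-below-δ 1′∘1′-jp x)))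
    (shift≤[1′·1′]′ x)
  [1′·1′]′≗shift ω = ≤ω-antisym x≤ω (shift≤[1′·1′]′ ω)

  𝟘·𝟘⁻¹≈1 : SatW negW (𝟘 · 𝟘⁻¹) one
  𝟘·𝟘⁻¹≈1 _ _ x = begin
    negW (λ y → y) (negW 1′∘1′ x) ≡⟨ 1′≗p _ ⟩
    p (negW 1′∘1′ x)              ≡⟨ cong p ([1′·1′]′≗shift x) ⟩
    p (shift x)                   ≡⟨ p∘shift≗id x ⟩
    x                             ∎
    where open ≡-Reasoning

  TimeWarp₀ : Set
  TimeWarp₀ = Σ (ω⁺ → ω⁺) IsTimeWarp

  -- TimeWarp is Set₁-valued; the carrier uses the equivalent small predicate IsTimeWarp.
  𝐖 : (c ℓ : Level) → Alg c ℓ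
  𝐖 c ℓ = record
    { Carrier = Lift c TimeWarp₀
    ; _≈_ = λ f g → Lift ℓ (∀ x → fun f x ≡ fun g x)
    ; isEquivalence = record
        { refl  = lift λ _ → refl
        ; sym   = λ f≗g → lift λ x → sym (lower f≗g x)
        ; trans = λ f≗g g≗h → lift λ x → trans (lower f≗g x) (lower g≗h x) }
    ; _∧ᴬ_ = λ (lift (f , f-tw)) (lift (g , g-tw)) → lift (_ , ⊓-isTimeWarp f-tw g-tw)
    ; _∨ᴬ_ = λ (lift (f , f-tw)) (lift (g , g-tw)) → lift (_ , ⊔-isTimeWarp f-tw g-tw)
    ; _·ᴬ_ = λ (lift (f , f-tw)) (lift (g , g-tw)) → lift (_ , ∘-isTimeWarp f-tw g-tw)
    ; _′ᴬ  = λ (lift (f , f-tw)) →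
               lift (negW f , TimeWarp⇒IsTimeWarp (′-joinPreserving (IsTimeWarp⇒TimeWarp f-tw)))
    ; 1ᴬ   = lift (_ , id-isTimeWarp)
    ; ∧-cong = λ f≗g h≗k → lift λ x → cong₂ _⊓ω_ (lower f≗g x) (lower h≗k x)
    ; ∨-cong = λ f≗g h≗k → lift λ x → cong₂ _⊔ω_ (lower f≗g x) (lower h≗k x)
    ; ·-cong = λ {f} f≗g h≗k → lift λ x → trans (cong (fun f) (lower h≗k x)) (lower f≗g _)
    ; ′-cong = λ {f} {g} f≗g → lift (′-cong (jp f) (jp g) (lower f≗g))
    }
    where
    fun : Lift c TimeWarp₀ → ω⁺ → ω⁺
    fun = proj₁ ∘ lower

    jp : (f : Lift c TimeWarp₀) → TimeWarp (fun f)
    jp = IsTimeWarp⇒TimeWarp ∘ proj₂ ∘ lower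

  evalA-𝐖 : ∀ (ρ : ℕ → Lift c TimeWarp₀) t →
            proj₁ (lower (evalA (𝐖 c ℓ) ρ t)) ≡ evalR ω⁺Chain negW (proj₁ ∘ lower ∘ ρ) t
  evalA-𝐖 ρ (var i) = refl
  evalA-𝐖 ρ (s ∧ t) = cong₂ (λ f g x → f x ⊓ω g x) (evalA-𝐖 ρ s) (evalA-𝐖 ρ t)
  evalA-𝐖 ρ (s ∨ t) = cong₂ (λ f g x → f x ⊔ω g x) (evalA-𝐖 ρ s) (evalA-𝐖 ρ t)
  evalA-𝐖 ρ (s · t) = cong₂ (λ f g x → f (g x)) (evalA-𝐖 ρ s) (evalA-𝐖 ρ t)
  evalA-𝐖 ρ (s ′)   = cong negW (evalA-𝐖 ρ s)
  evalA-𝐖 ρ one     = refl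

  𝐖∈V : InVW negW (𝐖 c ℓ)
  𝐖∈V s t W⊨s≈t ρ = lift λ x → begin
    proj₁ (lower (evalA (𝐖 _ _) ρ s)) x ≡⟨ cong-app (evalA-𝐖 ρ s) x ⟩
    evalR ω⁺Chain negW ρ₀ s x           ≡⟨ W⊨s≈t ρ₀ (IsTimeWarp⇒TimeWarp ∘ proj₂ ∘ lower ∘ ρ) x ⟩
    evalR ω⁺Chain negW ρ₀ t x           ≡⟨ cong-app (evalA-𝐖 ρ t) x ⟨
    proj₁ (lower (evalA (𝐖 _ _) ρ t)) x ∎
    where
    open ≡-Reasoning
    ρ₀ = proj₁ ∘ lower ∘ ρ

  𝐖⊭𝟘⁻¹·𝟘≈1 : ¬ Sat (𝐖 c ℓ) (𝟘⁻¹ · 𝟘) one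
  𝐖⊭𝟘⁻¹·𝟘≈1 𝐖⊨ = 0≢1 $ begin
    fin 0                               ≡⟨ [1′·1′]′≗shift (fin 0) ⟨
    negW 1′∘1′ (p (fin 1))              ≡⟨ cong (negW 1′∘1′) (1′≗p (fin 1)) ⟨
    negW 1′∘1′ (negW (λ y → y) (fin 1)) ≡⟨ lower (𝐖⊨ (λ _ → lift (_ , id-isTimeWarp))) (fin 1) ⟩
    fin 1                               ∎
    where
    open ≡-Reasoning
    0≢1 : fin 0 ≢ fin 1
    0≢1 ()

finite-member⊨𝟘⁻¹·𝟘≈1 : ∀ negW → IsRes′ ω⁺Chain negW → (A : Alg c ℓ) → InVW negW A → Finite A →
                        Sat A (𝟘⁻¹ · 𝟘) one
finite-member⊨𝟘⁻¹·𝟘≈1 negW isRes′ A A∈V finite ρ =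
  finite⇒dedekind-finite A-monoid finite (A∈V (𝟘 · 𝟘⁻¹) one (W.𝟘·𝟘⁻¹≈1 negW isRes′) ρ)
  where
  A-monoid : Monoid _ _
  A-monoid = ·-monoid A
    (A∈V ((var 0 · var 1) · var 2) (var 0 · (var 1 · var 2)) (·-assoc-Res ω⁺Chain negW))
    (A∈V (one · var 0) (var 0) (·-identityˡ-Res ω⁺Chain negW))
    (A∈V (var 0 · one) (var 0) (·-identityʳ-Res ω⁺Chain negW))

pred<fromℕ : ∀ {m} (i : Fin (suc (suc m))) → F.pred i F.< F.fromℕ (suc m)
pred<fromℕ F.zero    = s≤s z≤n
pred<fromℕ (F.suc j) = FP.ℕ<⇒inject₁< (s≤s (FP.≤fromℕ j))

FinChain⊭𝟘·𝟘⁻¹≈1 : ∀ n → 2 ≤ n → ∀ negC → IsRes′ (FinChain n) negC →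
                   ¬ SatRes (FinChain n) negC (𝟘 · 𝟘⁻¹) one
FinChain⊭𝟘·𝟘⁻¹≈1 (suc zero) (s≤s ())
FinChain⊭𝟘·𝟘⁻¹≈1 (suc (suc m)) _ negC isRes′ C⊨𝟘·𝟘⁻¹≈1 = NP.<-irrefl refl (begin-strict
  F.toℕ ⊤                  ≡⟨ cong F.toℕ (C⊨𝟘·𝟘⁻¹≈1 (λ _ x → x) (λ _ → id-jp) ⊤) ⟨
  F.toℕ (negC (λ x → x) y) ≤⟨ Res′.′-below-δ (FinChain _) isRes′ id-jp y ⟩
  F.toℕ (F.pred y)         <⟨ pred<fromℕ y ⟩
  F.toℕ ⊤                  ∎)
  where
  open NP.≤-Reasoning
  ⊤ = F.fromℕ (suc m)
  id-jp = id-joinPreserving (FinChain _)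
  y = negC (λ x → negC (λ z → z) (negC (λ z → z) x)) ⊤

proposition2p4 : (c ℓ : Level) → (negW : (ω⁺ → ω⁺) → (ω⁺ → ω⁺)) → IsRes′ ω⁺Chain negW →
    ¬ HasFMP negW c ℓ
    × ((n : ℕ) → 2 ≤ n → (negC : (Fin n → Fin n) → (Fin n → Fin n)) → IsRes′ (FinChain n) negC →
      ¬ (∀ s t → SatW negW s t → SatRes (FinChain n) negC s t))
proposition2p4 c ℓ negW isRes′ = no-FMP , Res[C]∉V
  where
  open W negW isRes′

  no-FMP : ¬ HasFMP negW c ℓ
  no-FMP has-FMP
    with A , A∈V , A-finite , A⊭𝟘⁻¹·𝟘≈1 ← has-FMP (𝟘⁻¹ · 𝟘) one (𝐖 c ℓ , 𝐖∈V , 𝐖⊭𝟘⁻¹·𝟘≈1)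
    = A⊭𝟘⁻¹·𝟘≈1 (finite-member⊨𝟘⁻¹·𝟘≈1 negW isRes′ A A∈V A-finite)

  Res[C]∉V : (n : ℕ) → 2 ≤ n → (negC : (Fin n → Fin n) → (Fin n → Fin n)) →
             IsRes′ (FinChain n) negC → ¬ (∀ s t → SatW negW s t → SatRes (FinChain n) negC s t)
  Res[C]∉V n 2≤n negC isRes′C Res[C]∈V =
    FinChain⊭𝟘·𝟘⁻¹≈1 n 2≤n negC isRes′C (Res[C]∈V (𝟘 · 𝟘⁻¹) one 𝟘·𝟘⁻¹≈1)
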